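{- In the canonical model for $\mathbb{PCL}$, if $S_X(Y,B)\in\mathcal{N}(X,A)$ and $(U,D)\in S_X(Y,B)$, then $S_X(U,D)\subseteq S_X(Y,B)$.
   Context: Formulas are built from atoms and $\bot$ by $\wedge,\vee,\rightarrow$ and a binary conditional $>$. The axiom system of $\mathbb{PCL}$ consists of classical propositional tautologies, modus ponens, the rules (RCEA) from $A\leftrightarrow B$ infer $(A>C)\leftrightarrow(B>C)$ and (RCK) from $A\rightarrow B$ infer $(C>A)\rightarrow(C>B)$, and axioms (ID) $A>A$, (R-And) $(A>B)\wedge(A>C)\rightarrow(A>(B\wedge C))$, (CM) $(A>B)\wedge(A>C)\rightarrow((A\wedge B)>C)$, (OR) $(A>C)\wedge(B>C)\rightarrow((A\vee B)>C)$. Maximal consistent sets are taken relative to this system ($S$ inconsistent iff some finite conjunction of its members provably implies $\bot$). For maximal consistent $X$: $X^B=\{C: B>C\in X\}$; $A\leq_X B$ iff $(A\vee B)>A\in X$. The canonical model: worlds $\mathcal{W}=\{(X,A): X \text{ maximal consistent}, A\in X\}$; valuation $\mathcal{V}(p)=\{(X,A)\in\mathcal{W}: p\in X\}$; for $(Y,B)\in\mathcal{W}$, $S_X(Y,B)=\{(Z,C)\in\mathcal{W}: X^C\subseteq Z,\ C\leq_X B,\ B\notin Z\}\cup\{(Y,B)\}$; and $\mathcal{N}(X,A)=\{S_X(Y,B): (Y,B)\in\mathcal{W},\ X^B\subseteq Y\}$. -}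

module Defs where

open import Data.Nat using (ℕ)
open import Data.Bool using (Bool; true; false; not) renaming (_∧_ to _&&_; _∨_ to _||_)
open import Data.List using (List; []; _∷_)
open import Data.List.Relation.Unary.All using (All)
open import Data.Product using (Σ; _×_; _,_)
open import Data.Sum using (_⊎_)
open import Relation.Binary.PropositionalEquality using (_≡_)
open import Relation.Nullary using (¬_)

infixr 6 _∧'_
infixr 5 _∨'_
infixr 4 _⇒_ _⇔_
infix 7 _⊳_

data Fm : Set where
  atom : ℕ → Fm
  ⊥'   : Fm
  _∧'_ : Fm → Fm → Fm
  _∨'_ : Fm → Fm → Fm
  _⇒_  : Fm → Fm → Fm
  _⊳_  : Fm → Fm → Fm

_⇔_ : Fm → Fm → Fm
A ⇔ B = (A ⇒ B) ∧' (B ⇒ A)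

eval : (Fm → Bool) → Fm → Bool
eval v (atom p) = v (atom p)
eval v ⊥'       = false
eval v (A ∧' B) = eval v A && eval v B
eval v (A ∨' B) = eval v A || eval v B
eval v (A ⇒ B)  = not (eval v A) || eval v B
eval v (A ⊳ B)  = v (A ⊳ B)

Tautology : Fm → Set
Tautology A = ∀ (v : Fm → Bool) → eval v A ≡ true

infix 2 ⊢_
data ⊢_ : Fm → Set where
  taut  : ∀ {A} → Tautology A → ⊢ A
  mp    : ∀ {A B} → ⊢ (A ⇒ B) → ⊢ A → ⊢ B
  rcea  : ∀ {A B C} → ⊢ (A ⇔ B) → ⊢ ((A ⊳ C) ⇔ (B ⊳ C))
  rck   : ∀ {A B C} → ⊢ (A ⇒ B) → ⊢ ((C ⊳ A) ⇒ (C ⊳ B))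
  ax-id : ∀ {A} → ⊢ (A ⊳ A)
  r-and : ∀ {A B C} → ⊢ (((A ⊳ B) ∧' (A ⊳ C)) ⇒ (A ⊳ (B ∧' C)))
  cm    : ∀ {A B C} → ⊢ (((A ⊳ B) ∧' (A ⊳ C)) ⇒ ((A ∧' B) ⊳ C))
  or    : ∀ {A B C} → ⊢ (((A ⊳ C) ∧' (B ⊳ C)) ⇒ ((A ∨' B) ⊳ C))

FmSet : Set₁
FmSet = Fm → Set

_⊆_ : FmSet → FmSet → Set
S ⊆ T = ∀ {A} → S A → T A

⋀ : List Fm → Fm
⋀ []       = ⊥' ⇒ ⊥'
⋀ (A ∷ Γ)  = A ∧' ⋀ Γ

Inconsistent : FmSet → Set
Inconsistent S = Σ (List Fm) λ Γ → All S Γ × (⊢ (⋀ Γ ⇒ ⊥'))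

Consistent : FmSet → Set
Consistent S = ¬ Inconsistent S

MaxCons : FmSet → Set₁
MaxCons X = Consistent X × (∀ (T : FmSet) → Consistent T → X ⊆ T → T ⊆ X)

_^_ : FmSet → Fm → FmSet
(X ^ B) C = X (B ⊳ C)

_≤[_]_ : Fm → FmSet → Fm → Set
A ≤[ X ] B = X ((A ∨' B) ⊳ A)

record World : Set₁ where
  constructor ⟨_,_⟩[_,_]
  field
    wset : FmSet
    wfm  : Fm
    wmax : MaxCons wset
    wmem : wset wfm
open World public

_≈W_ : World → World → Set
w ≈W w' = ((wset w ⊆ wset w') × (wset w' ⊆ wset w)) × (wfm w ≡ wfm w')

WSet : Set₁
WSet = World → Set

_⊆W_ : WSet → WSet → Set₁
P ⊆W Q = ∀ w → P w → Q w

_≐W_ : WSet → WSet → Set₁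
P ≐W Q = (P ⊆W Q) × (Q ⊆W P)

Sys : FmSet → World → WSet
Sys X y z =
  (((X ^ wfm z) ⊆ wset z) × (wfm z ≤[ X ] wfm y) × ¬ wset z (wfm y))
  ⊎ (z ≈W y)

Nbh : World → WSet → Set₁
Nbh x P = Σ World λ y → ((wset x ^ wfm y) ⊆ wset y) × (P ≐W Sys (wset x) y)

-- Write C ≤ B for C ≤_X B. If (U,D) lies in S_X(Y,B) other than as its centre, then
-- D ≤ B. A world (Z,C) of S_X(U,D) other than its centre has X^C ⊆ Z, C ≤ D and D ∉ Z.
-- From C ≤ D and D ≤ B, PCL yields (C ∨ D ∨ B) > C, and from it both C ≤ B and
-- C > (B → D); the latter puts B → D into Z, so B ∉ Z and (Z,C) lies in S_X(Y,B).
-- The centres are handled by S_X(Y,B) depending on (Y,B) only up to equality of worlds.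

module Submission where

open import Defs
open import Data.Bool using (Bool; true; false; not; T) renaming (_∧_ to _&&_; _∨_ to _||_)
open import Data.Bool.Properties using (∧-conicalˡ; ∧-conicalʳ; T-∧; T-≡)
open import Data.Fin using (Fin; zero; suc)
open import Data.List using (List; []; _∷_; _++_)
open import Data.List.Relation.Unary.All using (All; []; _∷_)
open import Data.List.Relation.Unary.All.Properties using (++⁺; ++⁻)
open import Data.Nat using (ℕ; zero; suc)
open import Data.Product using (Σ; _×_; _,_; proj₁; proj₂)
open import Data.Sum using (_⊎_; inj₁; inj₂)
open import Data.Vec using (Vec; []; _∷_; lookup; map)
open import Data.Vec.Properties using (lookup-map)
open import Function.Base using (_∘_)
open import Function.Bundles using (Equivalence)
open import Relation.Nullary using (¬_)
open import Relation.Binary.PropositionalEquality using (_≡_; refl; cong₂; sym; trans)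

private
  variable
    n : ℕ
    v : Fm → Bool
    A B C P Q : Fm
    Γ : List Fm

-- A record rather than a synonym for eval v F ≡ true, so that v and F can be inferred.
record Holds (v : Fm → Bool) (F : Fm) : Set where
  constructor holds
  field truth≡true : eval v F ≡ true
open Holds

private
  implies-intro : ∀ {a b} → (a ≡ true → b ≡ true) → (not a || b) ≡ true
  implies-intro {false} _ = refl
  implies-intro {true}  f = f refl

  implies-elim : ∀ {a b} → (not a || b) ≡ true → a ≡ true → b ≡ true
  implies-elim h refl = h

  and-intro : ∀ {a b} → a ≡ true → b ≡ true → (a && b) ≡ true
  and-intro refl refl = refl

⇒-intro : (Holds v P → Holds v Q) → Holds v (P ⇒ Q)
⇒-intro f = holds (implies-intro (truth≡true ∘ f ∘ holds))

⇒-elim : Holds v (P ⇒ Q) → Holds v P → Holds v Q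
⇒-elim (holds h) (holds p) = holds (implies-elim h p)

⋀-intro : All (Holds v) Γ → Holds v (⋀ Γ)
⋀-intro []             = holds refl
⋀-intro (holds h ∷ hs) = holds (and-intro h (truth≡true (⋀-intro hs)))

⋀-elim : Holds v (⋀ Γ) → All (Holds v) Γ
⋀-elim {v} {[]}    _         = []
⋀-elim {v} {F ∷ Γ} (holds h) = holds (∧-conicalˡ _ _ h) ∷ ⋀-elim (holds (∧-conicalʳ _ _ h))

infixr 6 _∧ₛ_
infixr 5 _∨ₛ_
infixr 4 _⇒ₛ_ _⇔ₛ_
infix 8 _⟨_⟩

data Schema (n : ℕ) : Set where
  var            : Fin n → Schema n
  ⊥ₛ             : Schema n
  _∧ₛ_ _∨ₛ_ _⇒ₛ_ : Schema n → Schema n → Schema n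

_⇔ₛ_ : Schema n → Schema n → Schema n
S ⇔ₛ S′ = (S ⇒ₛ S′) ∧ₛ (S′ ⇒ₛ S)

⊤ₛ : Schema n
⊤ₛ = ⊥ₛ ⇒ₛ ⊥ₛ

p : Schema (suc n)
p = var zero

q : Schema (suc (suc n))
q = var (suc zero)

r : Schema (suc (suc (suc n)))
r = var (suc (suc zero))

_⟨_⟩ : Schema n → Vec Fm n → Fm
var i    ⟨ σ ⟩ = lookup σ i
⊥ₛ       ⟨ σ ⟩ = ⊥'
(S ∧ₛ S′) ⟨ σ ⟩ = S ⟨ σ ⟩ ∧' S′ ⟨ σ ⟩
(S ∨ₛ S′) ⟨ σ ⟩ = S ⟨ σ ⟩ ∨' S′ ⟨ σ ⟩
(S ⇒ₛ S′) ⟨ σ ⟩ = S ⟨ σ ⟩ ⇒ S′ ⟨ σ ⟩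

truth : Schema n → Vec Bool n → Bool
truth (var i)   ρ = lookup ρ i
truth ⊥ₛ        ρ = false
truth (S ∧ₛ S′) ρ = truth S ρ && truth S′ ρ
truth (S ∨ₛ S′) ρ = truth S ρ || truth S′ ρ
truth (S ⇒ₛ S′) ρ = not (truth S ρ) || truth S′ ρ

eval-⟨⟩ : ∀ v (S : Schema n) σ → eval v (S ⟨ σ ⟩) ≡ truth S (map (eval v) σ)
eval-⟨⟩ v (var i)   σ = sym (lookup-map i (eval v) σ)
eval-⟨⟩ v ⊥ₛ        σ = refl
eval-⟨⟩ v (S ∧ₛ S′) σ = cong₂ _&&_ (eval-⟨⟩ v S σ) (eval-⟨⟩ v S′ σ)
eval-⟨⟩ v (S ∨ₛ S′) σ = cong₂ _||_ (eval-⟨⟩ v S σ) (eval-⟨⟩ v S′ σ)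
eval-⟨⟩ v (S ⇒ₛ S′) σ = cong₂ (λ a b → not a || b) (eval-⟨⟩ v S σ) (eval-⟨⟩ v S′ σ)

allVecs : ∀ n → (Vec Bool n → Bool) → Bool
allVecs zero    f = f []
allVecs (suc n) f = allVecs n (λ ρ → f (true ∷ ρ)) && allVecs n (λ ρ → f (false ∷ ρ))

allVecs-sound : ∀ {f} → T (allVecs n f) → ∀ ρ → T (f ρ)
allVecs-sound {zero}  h []          = h
allVecs-sound {suc n} h (true ∷ ρ)  = allVecs-sound (proj₁ (Equivalence.to T-∧ h)) ρ
allVecs-sound {suc n} h (false ∷ ρ) = allVecs-sound (proj₂ (Equivalence.to T-∧ h)) ρ

valid : Schema n → Bool
valid {n} S = allVecs n (truth S)

⊢-tautology : (S : Schema n) {_ : T (valid S)} (σ : Vec Fm n) → ⊢ S ⟨ σ ⟩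
⊢-tautology S {ok} σ = taut λ v →
  trans (eval-⟨⟩ v S σ) (Equivalence.to T-≡ (allVecs-sound ok (map (eval v) σ)))

module MaxConsTheory {X : FmSet} (maxX : MaxCons X) where

  private
    _∪｛_｝ : FmSet → Fm → FmSet
    (S ∪｛ A ｝) F = S F ⊎ F ≡ A

    splitOff : ∀ {Δ} → All (X ∪｛ A ｝) Δ →
      Σ (List Fm) λ Δx → All X Δx × (∀ {v} → Holds v A → All (Holds v) Δx → All (Holds v) Δ)
    splitOff [] = [] , [] , λ _ _ → []
    splitOff (inj₁ xF ∷ aΔ) with splitOff aΔ
    ... | Δx , xΔx , back = _ ∷ Δx , xF ∷ xΔx , λ { hA (hF ∷ hs) → hF ∷ back hA hs }
    splitOff (inj₂ refl ∷ aΔ) with splitOff aΔ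
    ... | Δx , xΔx , back = Δx , xΔx , λ hA hs → hA ∷ back hA hs

  ∈-closed : All X Γ → ⊢ (⋀ Γ ⇒ A) → X A
  ∈-closed {Γ} {A} xΓ ⊢Γ⇒A = proj₂ maxX (X ∪｛ A ｝) consistent inj₁ (inj₂ refl)
    where
    consistent : Consistent (X ∪｛ A ｝)
    consistent (Δ , aΔ , ⊢Δ⇒⊥) with splitOff aΔ
    ... | Δx , xΔx , back =
      proj₁ maxX (Γ ++ Δx , ++⁺ xΓ xΔx , mp (mp (taut (truth≡true ∘ τ)) ⊢Γ⇒A) ⊢Δ⇒⊥)
      where
      τ : ∀ v → Holds v ((⋀ Γ ⇒ A) ⇒ (⋀ Δ ⇒ ⊥') ⇒ ⋀ (Γ ++ Δx) ⇒ ⊥')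
      τ v = ⇒-intro λ hΓ⇒A → ⇒-intro λ hΔ⇒⊥ → ⇒-intro λ hΓΔx →
        let hΓ , hΔx = ++⁻ Γ (⋀-elim hΓΔx)
        in ⇒-elim hΔ⇒⊥ (⋀-intro (back (⇒-elim hΓ⇒A (⋀-intro hΓ)) hΔx))

  ∈-theorem : ⊢ A → X A
  ∈-theorem {A} ⊢A = ∈-closed [] (mp (⊢-tautology (p ⇒ₛ ⊤ₛ ⇒ₛ p) (A ∷ [])) ⊢A)

  ∈-mp : X A → ⊢ (A ⇒ B) → X B
  ∈-mp {A} {B} xA ⊢A⇒B =
    ∈-closed (xA ∷ []) (mp (⊢-tautology ((p ⇒ₛ q) ⇒ₛ p ∧ₛ ⊤ₛ ⇒ₛ q) (A ∷ B ∷ [])) ⊢A⇒B)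

  ∈-mp₂ : X A → X B → ⊢ (A ∧' B ⇒ C) → X C
  ∈-mp₂ {A} {B} {C} xA xB ⊢A∧B⇒C =
    ∈-closed (xA ∷ xB ∷ [])
      (mp (⊢-tautology ((p ∧ₛ q ⇒ₛ r) ⇒ₛ p ∧ₛ q ∧ₛ ⊤ₛ ⇒ₛ r) (A ∷ B ∷ C ∷ [])) ⊢A∧B⇒C)

  ∈-⇒ : X A → X (A ⇒ B) → X B
  ∈-⇒ {A} {B} xA xA⇒B = ∈-mp₂ xA xA⇒B (⊢-tautology (p ∧ₛ (p ⇒ₛ q) ⇒ₛ q) (A ∷ B ∷ []))

  ⊳-mono : X (A ⊳ B) → ⊢ (B ⇒ C) → X (A ⊳ C)
  ⊳-mono xA⊳B ⊢B⇒C = ∈-mp xA⊳B (rck ⊢B⇒C)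

  ⊳-congˡ : ⊢ (A ⇔ B) → X (A ⊳ C) → X (B ⊳ C)
  ⊳-congˡ {A} {B} {C} ⊢A⇔B xA⊳C =
    ∈-mp xA⊳C (mp (⊢-tautology ((p ⇔ₛ q) ⇒ₛ p ⇒ₛ q) ((A ⊳ C) ∷ (B ⊳ C) ∷ [])) (rcea ⊢A⇔B))

  ⊳-refl : X (A ⊳ A)
  ⊳-refl = ∈-theorem ax-id

  ⊳-∧ : X (A ⊳ B) → X (A ⊳ C) → X (A ⊳ (B ∧' C))
  ⊳-∧ xA⊳B xA⊳C = ∈-mp₂ xA⊳B xA⊳C r-and

  ⊳-cm : X (A ⊳ B) → X (A ⊳ C) → X ((A ∧' B) ⊳ C)
  ⊳-cm xA⊳B xA⊳C = ∈-mp₂ xA⊳B xA⊳C cm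

  ⊳-∨ : X (A ⊳ C) → X (B ⊳ C) → X ((A ∨' B) ⊳ C)
  ⊳-∨ xA⊳C xB⊳C = ∈-mp₂ xA⊳C xB⊳C or

  private
    σ₃ : Fm → Fm → Fm → Vec Fm 3
    σ₃ A B C = A ∷ B ∷ C ∷ []

  -- Split A into A ∧ B and A ∧ ¬B; on the second part B ⇒ C holds vacuously.
  ⊳-curry : X ((A ∧' B) ⊳ C) → X (A ⊳ (B ⇒ C))
  ⊳-curry {A} {B} {C} xA∧B⊳C =
    ⊳-congˡ (⊢-tautology ((p ∧ₛ q) ∨ₛ (p ∧ₛ (q ⇒ₛ ⊥ₛ)) ⇔ₛ p) (A ∷ B ∷ []))
      (⊳-∨ (⊳-mono xA∧B⊳C (⊢-tautology (r ⇒ₛ q ⇒ₛ r) (σ₃ A B C)))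
           (⊳-mono ⊳-refl (⊢-tautology (p ∧ₛ (q ⇒ₛ ⊥ₛ) ⇒ₛ q ⇒ₛ r) (σ₃ A B C))))

  ⊳-cut : X (A ⊳ B) → X ((A ∧' B) ⊳ C) → X (A ⊳ C)
  ⊳-cut {A} {B} {C} xA⊳B xA∧B⊳C =
    ⊳-mono (⊳-∧ xA⊳B (⊳-curry xA∧B⊳C)) (⊢-tautology (p ∧ₛ (p ⇒ₛ q) ⇒ₛ q) (B ∷ C ∷ []))

  ≤-least-of-chain : A ≤[ X ] B → B ≤[ X ] C → X ((A ∨' B ∨' C) ⊳ A)
  ≤-least-of-chain {A} {B} {C} A≤B B≤C = ⊳-cut chain⊳A∨B chain∧A∨B⊳A
    where
    chain⊳A∨B : X ((A ∨' B ∨' C) ⊳ (A ∨' B))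
    chain⊳A∨B = ⊳-congˡ (⊢-tautology ((p ∨ₛ q) ∨ₛ (q ∨ₛ r) ⇔ₛ p ∨ₛ q ∨ₛ r) (σ₃ A B C))
      (⊳-∨ ⊳-refl (⊳-mono B≤C (⊢-tautology (q ⇒ₛ p ∨ₛ q) (σ₃ A B C))))
    chain∧A∨B⊳A : X (((A ∨' B ∨' C) ∧' (A ∨' B)) ⊳ A)
    chain∧A∨B⊳A = ⊳-congˡ (⊢-tautology (p ∨ₛ q ⇔ₛ (p ∨ₛ q ∨ₛ r) ∧ₛ (p ∨ₛ q)) (σ₃ A B C)) A≤B

  ≤-trans : A ≤[ X ] B → B ≤[ X ] C → A ≤[ X ] C
  ≤-trans {A} {B} {C} A≤B B≤C =
    ⊳-congˡ (⊢-tautology ((p ∨ₛ q ∨ₛ r) ∧ₛ (p ∨ₛ r) ⇔ₛ p ∨ₛ r) (σ₃ A B C))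
      (⊳-cm (⊳-mono chain⊳A (⊢-tautology (p ⇒ₛ p ∨ₛ r) (σ₃ A B C))) chain⊳A)
    where
    chain⊳A : X ((A ∨' B ∨' C) ⊳ A)
    chain⊳A = ≤-least-of-chain A≤B B≤C

  ≤-trans-⊳⇒ : A ≤[ X ] B → B ≤[ X ] C → X (A ⊳ (C ⇒ B))
  ≤-trans-⊳⇒ {A} {B} {C} A≤B B≤C =
    ⊳-congˡ (⊢-tautology ((p ∨ₛ q ∨ₛ r) ∧ₛ p ⇔ₛ p) (σ₃ A B C))
      (⊳-cm (≤-least-of-chain A≤B B≤C) chain⊳C⇒B)
    where
    chain⊳C⇒B : X ((A ∨' B ∨' C) ⊳ (C ⇒ B))
    chain⊳C⇒B = ⊳-mono
      (⊳-curry (⊳-congˡ (⊢-tautology (q ∨ₛ r ⇔ₛ (p ∨ₛ q ∨ₛ r) ∧ₛ (q ∨ₛ r)) (σ₃ A B C)) B≤C))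
      (⊢-tautology ((q ∨ₛ r ⇒ₛ q) ⇒ₛ r ⇒ₛ q) (σ₃ A B C))

Sys⁻ : FmSet → World → WSet
Sys⁻ X y z = ((X ^ wfm z) ⊆ wset z) × (wfm z ≤[ X ] wfm y) × ¬ wset z (wfm y)

≈W-trans : ∀ {w₁ w₂ w₃} → w₁ ≈W w₂ → w₂ ≈W w₃ → w₁ ≈W w₃
≈W-trans ((w₁⊆w₂ , w₂⊆w₁) , e₁₂) ((w₂⊆w₃ , w₃⊆w₂) , e₂₃) =
  ((λ h → w₂⊆w₃ (w₁⊆w₂ h)) , (λ h → w₂⊆w₁ (w₃⊆w₂ h))) , trans e₁₂ e₂₃

Sys⁻-resp-≈W : ∀ X {y z w} → z ≈W w → Sys⁻ X y w → Sys⁻ X y z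
Sys⁻-resp-≈W X {z = ⟨ Z , C ⟩[ _ , _ ]} {w = ⟨ W , .C ⟩[ _ , _ ]}
  ((Z⊆W , W⊆Z) , refl) (X^C⊆W , C≤ , y∉W) =
  (λ h → W⊆Z (X^C⊆W h)) , C≤ , λ y∈Z → y∉W (Z⊆W y∈Z)

Sys-resp-≈W : ∀ X {y y′} → y ≈W y′ → Sys X y ⊆W Sys X y′
Sys-resp-≈W X {y = ⟨ _ , B ⟩[ _ , _ ]} {y′ = ⟨ _ , .B ⟩[ _ , _ ]} (_ , refl) z (inj₁ z∈Sys⁻y) =
  inj₁ z∈Sys⁻y
Sys-resp-≈W X {y} {y′} y≈y′ z (inj₂ z≈y) = inj₂ (≈W-trans {z} {y} {y′} z≈y y≈y′)

Sys⁻-trans : ∀ X → MaxCons X → ∀ {y u} z → Sys⁻ X u z → wfm u ≤[ X ] wfm y → Sys⁻ X y z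
Sys⁻-trans X maxX z (X^C⊆Z , C≤D , D∉Z) D≤B =
  X^C⊆Z , ≤-trans C≤D D≤B , λ B∈Z → D∉Z (∈-⇒ (wmax z) B∈Z (X^C⊆Z (≤-trans-⊳⇒ C≤D D≤B)))
  where
  open MaxConsTheory maxX using (≤-trans; ≤-trans-⊳⇒)
  open MaxConsTheory using (∈-⇒)

mainTheorem6 : (x y u : World) →
    Nbh x (Sys (wset x) y) →
    Sys (wset x) y u →
    Sys (wset x) u ⊆W Sys (wset x) y
mainTheorem6 x y u _ (inj₂ u≈y) = Sys-resp-≈W (wset x) {u} {y} u≈y
mainTheorem6 x y u _ (inj₁ (_ , D≤B , _)) z (inj₁ z∈Sys⁻u) =
  inj₁ (Sys⁻-trans (wset x) (wmax x) {y} {u} z z∈Sys⁻u D≤B)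
mainTheorem6 x y u _ (inj₁ u∈Sys⁻y) z (inj₂ z≈u) =
  inj₁ (Sys⁻-resp-≈W (wset x) {y} {z} {u} z≈u u∈Sys⁻y)
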